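{- Let $n \ge 4$ and let $u_1,\dots, u_n$ be a minimal zero-sum sequence in $\mathbb{Z}^3$ whose support has size $4$, say $\{w_1,w_2,w_3,w_4\}$. Then $n$ is at most the number of points of $\mathbb{Z}^3$ lying in $D(w_1,w_2,w_3,w_4)$, the convex hull of the $14$ points $w_i$ ($1\le i\le 4$), $w_i+w_j$ ($1\le i<j\le4$) and $w_i+w_j+w_k$ ($1\le i<j<k\le 4$).
   Context: A minimal zero-sum sequence is a finite unordered sequence (multiset) $u_1,\dots,u_n$ with $\sum_i u_i=0$ and $\sum_{i\in I}u_i\ne0$ for every non-empty proper subset $I\subsetneq\{1,\dots,n\}$; its support is the set of distinct elements among the $u_i$. -}

module Defs where

open import Data.Nat using (ℕ; zero; suc)
open import Data.Bool using (if_then_else_)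
open import Data.Integer as ℤ using (ℤ)
open import Data.Rational as ℚ using (ℚ; 0ℚ; 1ℚ)
open import Data.Fin using (Fin; zero; suc)
open import Data.Fin.Subset using (Subset; _∈_; _∉_; Nonempty)
open import Data.Vec using (lookup)
open import Data.List using (List; []; _∷_; length)
import Data.List as List
open import Data.Product using (_×_; _,_; ∃; Σ)
open import Relation.Binary.PropositionalEquality using (_≡_; _≢_)
open import Function.Definitions using (Injective)

record ℤ³ : Set where
  constructor ⟨_,_,_⟩
  field x y z : ℤ

open ℤ³ public

0³ : ℤ³
0³ = ⟨ ℤ.0ℤ , ℤ.0ℤ , ℤ.0ℤ ⟩

infixl 6 _+³_
_+³_ : ℤ³ → ℤ³ → ℤ³
⟨ a , b , c ⟩ +³ ⟨ d , e , f ⟩ = ⟨ a ℤ.+ d , b ℤ.+ e , c ℤ.+ f ⟩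

Σ³ : ∀ {n} → (Fin n → ℤ³) → ℤ³
Σ³ {zero}  u = 0³
Σ³ {suc n} u = u zero +³ Σ³ (λ i → u (suc i))

Σ³[_] : ∀ {n} → Subset n → (Fin n → ℤ³) → ℤ³
Σ³[ I ] u = Σ³ (λ i → if lookup I i then u i else 0³)

-- Minimal zero-sum sequence u_1,…,u_n (sequence given as a family Fin n → ℤ³;
-- the notion is invariant under reindexing, so this represents the multiset)
IsMinimalZeroSum : ∀ {n} → (Fin n → ℤ³) → Set
IsMinimalZeroSum {n} u =
  (Σ³ u ≡ 0³) ×
  (∀ (I : Subset n) → Nonempty I → (∃ λ i → i ∉ I) → Σ³[ I ] u ≢ 0³)

SupportIs : ∀ {n} → (Fin n → ℤ³) → (Fin 4 → ℤ³) → Set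
SupportIs {n} u w =
  Injective _≡_ _≡_ w ×
  (∀ (i : Fin n) → ∃ λ (j : Fin 4) → u i ≡ w j) ×
  (∀ (j : Fin 4) → ∃ λ (i : Fin n) → u i ≡ w j)

Σℚ : ∀ {n} → (Fin n → ℚ) → ℚ
Σℚ {zero}  f = 0ℚ
Σℚ {suc n} f = f zero ℚ.+ Σℚ (λ i → f (suc i))

toℚ : ℤ → ℚ
toℚ a = a ℚ./ 1

InConvexHull : List ℤ³ → ℤ³ → Set
InConvexHull L p =
  Σ (Fin (length L) → ℚ) λ c →
    (∀ k → 0ℚ ℚ.≤ c k) ×
    (Σℚ c ≡ 1ℚ) ×
    (Σℚ (λ k → c k ℚ.* toℚ (x (List.lookup L k))) ≡ toℚ (x p)) ×
    (Σℚ (λ k → c k ℚ.* toℚ (y (List.lookup L k))) ≡ toℚ (y p)) ×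
    (Σℚ (λ k → c k ℚ.* toℚ (z (List.lookup L k))) ≡ toℚ (z p))

generatorsD : (Fin 4 → ℤ³) → List ℤ³
generatorsD w =
  w0 ∷ w1 ∷ w2 ∷ w3 ∷
  (w0 +³ w1) ∷ (w0 +³ w2) ∷ (w0 +³ w3) ∷ (w1 +³ w2) ∷ (w1 +³ w3) ∷ (w2 +³ w3) ∷
  (w0 +³ w1 +³ w2) ∷ (w0 +³ w1 +³ w3) ∷ (w0 +³ w2 +³ w3) ∷ (w1 +³ w2 +³ w3) ∷ []
  where
    w0 = w zero
    w1 = w (suc zero)
    w2 = w (suc (suc zero))
    w3 = w (suc (suc (suc zero)))

InD : (Fin 4 → ℤ³) → ℤ³ → Set
InD w p = InConvexHull (generatorsD w) p

-- Let aₗ ≥ 1 be the multiplicity of wₗ in u, so that Σ aₗ wₗ = 0 and Σ aₗ = n.  Starting from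
-- b = 0 and repeatedly adding one to a coordinate l minimising (bₗ + 1)/aₗ gives vectors
-- b⁰ ≤ b¹ ≤ … ≤ bⁿ⁻¹ ≤ a with Σ bᵏ = k which stay balanced: max bₗ/aₗ ≤ min (bₗ + 1)/aₗ.
-- The points Pₖ = Σ (bᵏₗ + 1) wₗ are distinct, for Pₖ = Pₖ′ would make bᵏ′ − bᵏ a nonempty
-- proper zero-sum subsequence of u.  For balanced b, let i maximise bᵢ/aᵢ and let j ≠ i be such
-- that i or j minimises (b + 1)/a; with t the mediant (bᵢ + bⱼ + 1)/(aᵢ + aⱼ) we get
-- P = Σ (bₗ + 1 − t aₗ) wₗ, all coefficients lie in [0, 1] and those of wᵢ and wⱼ add up to 1.
-- So P lies in the prism spanned over the segment [wᵢ, wⱼ] by the two other wₗ, whose eight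
-- vertices are among the fourteen points defining D.
module Submission where

open import Defs
open import Algebra.Bundles using (AbelianGroup; CommutativeMonoid; CommutativeRing)
import Algebra.Properties.CommutativeMonoid.Sum as MonoidSum
import Algebra.Properties.Group as GroupProperties
import Algebra.Properties.Semiring.Sum as SemiringSum
import Algebra.Solver.CommutativeMonoid as CommutativeMonoidSolver
open import Data.Empty using (⊥-elim)
open import Data.Fin as F using (Fin; zero; suc; #_)
open import Data.Fin.Patterns using (0F; 1F; 2F; 3F)
import Data.Fin.Properties as FP
open import Data.Fin.Subset using (Subset; _∈_; _∉_; Nonempty; ∣_∣; ⊤; inside; outside)
import Data.Fin.Subset.Properties as SP
open import Data.Integer as ℤ using (ℤ; +_)
import Data.Integer.Properties as ℤP
import Data.Integer.Tactic.RingSolver as ℤ-Solver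
open import Data.List as List using (List; length)
open import Data.Nat as ℕ using (ℕ; zero; suc; _≤_; _<_; z≤n; s≤s; NonZero)
import Data.Nat.Properties as ℕP
import Data.Nat.Tactic.RingSolver as ℕ-Solver
open import Data.Product using (Σ; ∃; ∃₂; _×_; _,_; proj₁; proj₂)
open import Data.Rational as ℚ using (ℚ; 0ℚ; 1ℚ)
import Data.Rational.Properties as ℚP
import Data.Rational.Unnormalised as ℚᵘ
import Data.Rational.Unnormalised.Properties as ℚᵘP
open import Data.Sum using (_⊎_; inj₁; inj₂)
open import Data.Vec using ([]; _∷_)
open import Function.Base using (_∘_; flip)
open import Function.Definitions using (Injective)
open import Level using (0ℓ)
open import Relation.Binary.Definitions using (tri<; tri≈; tri>)
open import Relation.Binary.PropositionalEquality
open import Relation.Nullary using (Dec; yes; no; ¬_)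
import Relation.Nullary.Decidable as Dec

private
  module ℕΣ = MonoidSum ℕP.+-0-commutativeMonoid
  module ℚΣ = MonoidSum ℚP.+-0-commutativeMonoid
  module ℚΣ* = SemiringSum (CommutativeRing.semiring ℚP.+-*-commutativeRing)

-- Integer combinations of points of ℤ³

infixr 7 _•_
_•_ : ℕ → ℤ³ → ℤ³
n • p = ⟨ + n ℤ.* x p , + n ℤ.* y p , + n ℤ.* z p ⟩

ℤ³-ext : ∀ {p q} → x p ≡ x q → y p ≡ y q → z p ≡ z q → p ≡ q
ℤ³-ext {⟨ _ , _ , _ ⟩} {⟨ _ , _ , _ ⟩} refl refl refl = refl

ℤ³-+-commutativeMonoid : CommutativeMonoid 0ℓ 0ℓ
ℤ³-+-commutativeMonoid = record
  { Carrier = ℤ³ ; _≈_ = _≡_ ; _∙_ = _+³_ ; ε = 0³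
  ; isCommutativeMonoid = record
    { isMonoid = record
      { isSemigroup = record
        { isMagma = record { isEquivalence = isEquivalence ; ∙-cong = cong₂ _+³_ }
        ; assoc   = λ p q r → ℤ³-ext (ℤP.+-assoc (x p) (x q) (x r)) (ℤP.+-assoc (y p) (y q) (y r))
                                     (ℤP.+-assoc (z p) (z q) (z r))
        }
      ; identity = (λ p → ℤ³-ext (ℤP.+-identityˡ (x p)) (ℤP.+-identityˡ (y p))
                                 (ℤP.+-identityˡ (z p)))
                 , (λ p → ℤ³-ext (ℤP.+-identityʳ (x p)) (ℤP.+-identityʳ (y p))
                                 (ℤP.+-identityʳ (z p)))
      }
    ; comm = λ p q → ℤ³-ext (ℤP.+-comm (x p) (x q)) (ℤP.+-comm (y p) (y q))
                            (ℤP.+-comm (z p) (z q))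
    }
  }

open CommutativeMonoid ℤ³-+-commutativeMonoid
  using () renaming (identityˡ to +³-identityˡ; identityʳ to +³-identityʳ)

module ℤ³-Solver = CommutativeMonoidSolver ℤ³-+-commutativeMonoid

+³-identityʳ-unique : ∀ p q → p +³ q ≡ p → q ≡ 0³
+³-identityʳ-unique p q e =
  ℤ³-ext (unique (x p) (x q) (cong x e)) (unique (y p) (y q) (cong y e)) (unique (z p) (z q) (cong z e))
  where
  open GroupProperties (AbelianGroup.group ℤP.+-0-abelianGroup) renaming (identityʳ-unique to unique)

•-distribʳ : ∀ m n p → (m ℕ.+ n) • p ≡ m • p +³ n • p
•-distribʳ m n p = ℤ³-ext (distrib (x p)) (distrib (y p)) (distrib (z p))
  where
  distrib : ∀ a → + (m ℕ.+ n) ℤ.* a ≡ + m ℤ.* a ℤ.+ + n ℤ.* a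
  distrib a = trans (cong (ℤ._* a) (ℤP.pos-+ m n)) (ℤP.*-distribʳ-+ a (+ m) (+ n))

•-distribˡ : ∀ n p q → n • (p +³ q) ≡ n • p +³ n • q
•-distribˡ n p q = ℤ³-ext (ℤP.*-distribˡ-+ (+ n) (x p) (x q)) (ℤP.*-distribˡ-+ (+ n) (y p) (y q))
                         (ℤP.*-distribˡ-+ (+ n) (z p) (z q))

•-assoc : ∀ m n p → (m ℕ.* n) • p ≡ m • n • p
•-assoc m n p = ℤ³-ext (assoc (x p)) (assoc (y p)) (assoc (z p))
  where
  assoc : ∀ a → + (m ℕ.* n) ℤ.* a ≡ + m ℤ.* (+ n ℤ.* a)
  assoc a = trans (cong (ℤ._* a) (ℤP.pos-* m n)) (ℤP.*-assoc (+ m) (+ n) a)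

•-identityˡ : ∀ p → 1 • p ≡ p
•-identityˡ p = ℤ³-ext (ℤP.*-identityˡ (x p)) (ℤP.*-identityˡ (y p)) (ℤP.*-identityˡ (z p))

•-zeroʳ : ∀ n → n • 0³ ≡ 0³
•-zeroʳ n = ℤ³-ext (ℤP.*-zeroʳ (+ n)) (ℤP.*-zeroʳ (+ n)) (ℤP.*-zeroʳ (+ n))

Σ³-cong : ∀ {n} {f g : Fin n → ℤ³} → (∀ k → f k ≡ g k) → Σ³ f ≡ Σ³ g
Σ³-cong {zero}  f≗g = refl
Σ³-cong {suc n} f≗g = cong₂ _+³_ (f≗g zero) (Σ³-cong (f≗g ∘ suc))

Σ³-+ : ∀ {n} (f g : Fin n → ℤ³) → Σ³ (λ k → f k +³ g k) ≡ Σ³ f +³ Σ³ g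
Σ³-+ {zero}  f g = refl
Σ³-+ {suc n} f g = trans (cong (f zero +³ g zero +³_) (Σ³-+ (f ∘ suc) (g ∘ suc)))
  (solve 4 (λ a b c d → (a ⊕ b) ⊕ (c ⊕ d) ⊜ (a ⊕ c) ⊕ (b ⊕ d)) refl
           (f zero) (g zero) (Σ³ (f ∘ suc)) (Σ³ (g ∘ suc)))
  where open ℤ³-Solver using (solve; _⊕_; _⊜_)

Σ³-• : ∀ {n} m (f : Fin n → ℤ³) → Σ³ (λ k → m • f k) ≡ m • Σ³ f
Σ³-• {zero}  m f = sym (•-zeroʳ m)
Σ³-• {suc n} m f = trans (cong (m • f zero +³_) (Σ³-• m (f ∘ suc)))
                         (sym (•-distribˡ m (f zero) (Σ³ (f ∘ suc))))

δ : ∀ {n} → Fin n → Fin n → ℕ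
δ zero    zero    = 1
δ zero    (suc _) = 0
δ (suc _) zero    = 0
δ (suc i) (suc j) = δ i j

δ-diag : ∀ {n} (j : Fin n) → δ j j ≡ 1
δ-diag zero    = refl
δ-diag (suc j) = δ-diag j

δ-off : ∀ {n} {i j : Fin n} → i ≢ j → δ i j ≡ 0
δ-off {i = zero}  {zero}  i≢j = ⊥-elim (i≢j refl)
δ-off {i = zero}  {suc _} _   = refl
δ-off {i = suc _} {zero}  _   = refl
δ-off {i = suc i} {suc j} i≢j = δ-off (i≢j ∘ cong suc)

sum-δ : ∀ {n} (j : Fin n) → ℕΣ.sum (δ j) ≡ 1
sum-δ {suc n} zero    = cong suc (ℕΣ.sum-replicate-zero n)
sum-δ         (suc j) = sum-δ j

sum-mono : ∀ {n} {c d : Fin n → ℕ} → (∀ l → c l ≤ d l) → ℕΣ.sum c ≤ ℕΣ.sum d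
sum-mono {zero}  _   = z≤n
sum-mono {suc n} c≤d = ℕP.+-mono-≤ (c≤d zero) (sum-mono (c≤d ∘ suc))

comb : ∀ {m} → (Fin m → ℤ³) → (Fin m → ℕ) → ℤ³
comb w c = Σ³ (λ l → c l • w l)

module _ {m} (w : Fin m → ℤ³) where

  comb-cong : ∀ {c d} → (∀ l → c l ≡ d l) → comb w c ≡ comb w d
  comb-cong c≗d = Σ³-cong (λ l → cong (_• w l) (c≗d l))

  comb-zero : ∀ {c} → (∀ l → c l ≡ 0) → comb w c ≡ 0³
  comb-zero c≗0 = trans (comb-cong c≗0) (Σ³-• 0 w)

  comb-+ : ∀ c d → comb w (λ l → c l ℕ.+ d l) ≡ comb w c +³ comb w d
  comb-+ c d = trans (Σ³-cong (λ l → •-distribʳ (c l) (d l) (w l)))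
                     (Σ³-+ (λ l → c l • w l) (λ l → d l • w l))

  comb-* : ∀ n c → comb w (λ l → n ℕ.* c l) ≡ n • comb w c
  comb-* n c = trans (Σ³-cong (λ l → •-assoc n (c l) (w l))) (Σ³-• n (λ l → c l • w l))

comb-δ : ∀ {m} (w : Fin m → ℤ³) j → comb w (δ j) ≡ w j
comb-δ w zero    = trans (cong₂ _+³_ (•-identityˡ (w zero)) (Σ³-• 0 (w ∘ suc)))
                         (+³-identityʳ (w zero))
comb-δ w (suc j) = trans (cong (0 • w zero +³_) (comb-δ (w ∘ suc) j)) (+³-identityˡ (w (suc j)))

comb-δ+ : ∀ {m} (w : Fin m → ℤ³) j c → comb w (λ l → δ j l ℕ.+ c l) ≡ w j +³ comb w c
comb-δ+ w j c = trans (comb-+ w (δ j) c) (cong (_+³ comb w c) (comb-δ w j))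

-- Convex combinations with rational weights

toℚᵘ-toℚ : ∀ a → ℚᵘ._≃_ (ℚ.toℚᵘ (toℚ a)) (ℚᵘ.mkℚᵘ a 0)
toℚᵘ-toℚ a = ℚP.toℚᵘ-fromℚᵘ (ℚᵘ.mkℚᵘ a 0)

toℚ-+ : ∀ a b → toℚ (a ℤ.+ b) ≡ toℚ a ℚ.+ toℚ b
toℚ-+ a b = ℚP.toℚᵘ-injective (begin
  ℚ.toℚᵘ (toℚ (a ℤ.+ b))                ≈⟨ toℚᵘ-toℚ (a ℤ.+ b) ⟩
  ℚᵘ.mkℚᵘ (a ℤ.+ b) 0
    ≈⟨ ℚᵘ.*≡* (cong (ℤ._* + 1) (cong₂ ℤ._+_ (sym (ℤP.*-identityʳ a)) (sym (ℤP.*-identityʳ b)))) ⟩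
  ℚᵘ.mkℚᵘ a 0 ℚᵘ.+ ℚᵘ.mkℚᵘ b 0          ≈⟨ ℚᵘP.+-cong (toℚᵘ-toℚ a) (toℚᵘ-toℚ b) ⟨
  ℚ.toℚᵘ (toℚ a) ℚᵘ.+ ℚ.toℚᵘ (toℚ b)    ≈⟨ ℚP.toℚᵘ-homo-+ (toℚ a) (toℚ b) ⟨
  ℚ.toℚᵘ (toℚ a ℚ.+ toℚ b)              ∎)
  where open ℚᵘP.≃-Reasoning

toℚ-* : ∀ a b → toℚ (a ℤ.* b) ≡ toℚ a ℚ.* toℚ b
toℚ-* a b = ℚP.toℚᵘ-injective (begin
  ℚ.toℚᵘ (toℚ (a ℤ.* b))                ≈⟨ toℚᵘ-toℚ (a ℤ.* b) ⟩
  ℚᵘ.mkℚᵘ a 0 ℚᵘ.* ℚᵘ.mkℚᵘ b 0          ≈⟨ ℚᵘP.*-cong (toℚᵘ-toℚ a) (toℚᵘ-toℚ b) ⟨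
  ℚ.toℚᵘ (toℚ a) ℚᵘ.* ℚ.toℚᵘ (toℚ b)    ≈⟨ ℚP.toℚᵘ-homo-* (toℚ a) (toℚ b) ⟨
  ℚ.toℚᵘ (toℚ a ℚ.* toℚ b)              ∎)
  where open ℚᵘP.≃-Reasoning

1/n*n≡1 : ∀ n .{{_ : NonZero n}} → (+ 1 ℚ./ n) ℚ.* toℚ (+ n) ≡ 1ℚ
1/n*n≡1 (suc n) = ℚP.toℚᵘ-injective (begin
  ℚ.toℚᵘ ((+ 1 ℚ./ suc n) ℚ.* toℚ (+ suc n))
    ≈⟨ ℚP.toℚᵘ-homo-* (+ 1 ℚ./ suc n) (toℚ (+ suc n)) ⟩
  ℚ.toℚᵘ (+ 1 ℚ./ suc n) ℚᵘ.* ℚ.toℚᵘ (toℚ (+ suc n))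
    ≈⟨ ℚᵘP.*-cong (ℚP.toℚᵘ-fromℚᵘ (ℚᵘ.mkℚᵘ (+ 1) n)) (toℚᵘ-toℚ (+ suc n)) ⟩
  ℚᵘ.mkℚᵘ (+ 1) n ℚᵘ.* ℚᵘ.mkℚᵘ (+ suc n) 0
    ≈⟨ ℚᵘ.*≡* (cross-multiplied (+ suc n)) ⟩
  ℚ.toℚᵘ 1ℚ
    ∎)
  where
  open ℚᵘP.≃-Reasoning
  cross-multiplied : ∀ m → (+ 1 ℤ.* m) ℤ.* + 1 ≡ + 1 ℤ.* (m ℤ.* + 1)
  cross-multiplied = ℤ-Solver.solve-∀

Σℚ≡sum : ∀ {n} (f : Fin n → ℚ) → Σℚ f ≡ ℚΣ.sum f
Σℚ≡sum {zero}  f = refl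
Σℚ≡sum {suc n} f = cong (f zero ℚ.+_) (Σℚ≡sum (f ∘ suc))

Σℚ-cong : ∀ {n} {f g : Fin n → ℚ} → (∀ k → f k ≡ g k) → Σℚ f ≡ Σℚ g
Σℚ-cong {zero}  f≗g = refl
Σℚ-cong {suc n} f≗g = cong₂ ℚ._+_ (f≗g zero) (Σℚ-cong (f≗g ∘ suc))

Σℚ-+ : ∀ {n} (f g : Fin n → ℚ) → Σℚ (λ k → f k ℚ.+ g k) ≡ Σℚ f ℚ.+ Σℚ g
Σℚ-+ f g = trans (Σℚ≡sum (λ k → f k ℚ.+ g k))
                 (trans (ℚΣ.∑-distrib-+ f g) (sym (cong₂ ℚ._+_ (Σℚ≡sum f) (Σℚ≡sum g))))

Σℚ-*ˡ : ∀ {n} r (f : Fin n → ℚ) → Σℚ (λ k → r ℚ.* f k) ≡ r ℚ.* Σℚ f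
Σℚ-*ˡ r f = trans (Σℚ≡sum (λ k → r ℚ.* f k))
                  (sym (trans (cong (r ℚ.*_) (Σℚ≡sum f)) (ℚΣ*.*-distribˡ-sum r f)))

Σℚ-δ : ∀ {n} (j : Fin n) (f : Fin n → ℚ) → Σℚ (λ k → toℚ (+ δ j k) ℚ.* f k) ≡ f j
Σℚ-δ {suc n} zero f = begin
  1ℚ ℚ.* f zero ℚ.+ Σℚ (λ k → 0ℚ ℚ.* f (suc k))
    ≡⟨ cong₂ ℚ._+_ (ℚP.*-identityˡ (f zero)) (Σℚ-*ˡ 0ℚ (f ∘ suc)) ⟩
  f zero ℚ.+ 0ℚ ℚ.* Σℚ (f ∘ suc)   ≡⟨ cong (f zero ℚ.+_) (ℚP.*-zeroˡ (Σℚ (f ∘ suc))) ⟩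
  f zero ℚ.+ 0ℚ                    ≡⟨ ℚP.+-identityʳ (f zero) ⟩
  f zero                           ∎
  where open ≡-Reasoning
Σℚ-δ {suc n} (suc j) f = trans (cong₂ ℚ._+_ (ℚP.*-zeroˡ (f zero)) (Σℚ-δ j (f ∘ suc)))
                               (ℚP.+-identityˡ (f (suc j)))

weighted : (L : List ℤ³) → (Fin (length L) → ℚ) → (ℤ³ → ℤ) → ℚ
weighted L c π = Σℚ (λ k → c k ℚ.* toℚ (π (List.lookup L k)))

weighted-+ : ∀ L (c d : Fin (length L) → ℚ) π →
  weighted L (λ k → c k ℚ.+ d k) π ≡ weighted L c π ℚ.+ weighted L d π
weighted-+ L c d π = trans (Σℚ-cong (λ k → ℚP.*-distribʳ-+ (value k) (c k) (d k)))
                           (Σℚ-+ (λ k → c k ℚ.* value k) (λ k → d k ℚ.* value k))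
  where
  value : Fin (length L) → ℚ
  value k = toℚ (π (List.lookup L k))

weighted-*ˡ : ∀ L r (c : Fin (length L) → ℚ) π →
  weighted L (λ k → r ℚ.* c k) π ≡ r ℚ.* weighted L c π
weighted-*ˡ L r c π = trans (Σℚ-cong (λ k → ℚP.*-assoc r (c k) (value k)))
                            (Σℚ-*ˡ r (λ k → c k ℚ.* value k))
  where
  value : Fin (length L) → ℚ
  value k = toℚ (π (List.lookup L k))

-- Q / S is a convex combination of the points of L, with weights coefficient / S.
record InCone (L : List ℤ³) (S : ℕ) (Q : ℤ³) : Set where
  constructor cone
  field
    coefficient : Fin (length L) → ℚ
    nonneg      : ∀ k → 0ℚ ℚ.≤ coefficient k
    total       : Σℚ coefficient ≡ toℚ (+ S)
    weighted-x  : weighted L coefficient x ≡ toℚ (x Q)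
    weighted-y  : weighted L coefficient y ≡ toℚ (y Q)
    weighted-z  : weighted L coefficient z ≡ toℚ (z Q)

InCone⇒InConvexHull : ∀ {L P} → InCone L 1 P → InConvexHull L P
InCone⇒InConvexHull (cone c c≥0 Σc cx cy cz) = c , c≥0 , Σc , cx , cy , cz

inCone-lookup : ∀ L k → InCone L 1 (List.lookup L k)
inCone-lookup L k =
  cone (λ k′ → toℚ (+ δ k k′)) nonneg total (Σℚ-δ k (value x)) (Σℚ-δ k (value y)) (Σℚ-δ k (value z))
  where
  value : (ℤ³ → ℤ) → Fin (length L) → ℚ
  value π k′ = toℚ (π (List.lookup L k′))
  nonneg : ∀ k′ → 0ℚ ℚ.≤ toℚ (+ δ k k′)
  nonneg k′ = ℚP.nonNegative⁻¹ _ {{ℚP.normalize-nonNeg (δ k k′) 1}}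
  total : Σℚ (λ k′ → toℚ (+ δ k k′)) ≡ 1ℚ
  total = trans (Σℚ-cong (λ k′ → sym (ℚP.*-identityʳ (toℚ (+ δ k k′))))) (Σℚ-δ k (λ _ → 1ℚ))

inCone-+ : ∀ {L S T P Q} → InCone L S P → InCone L T Q → InCone L (S ℕ.+ T) (P +³ Q)
inCone-+ {L} {S} {T} {P} {Q} (cone c c≥0 Σc cx cy cz) (cone d d≥0 Σd dx dy dz) =
  cone (λ k → c k ℚ.+ d k) (λ k → ℚP.+-mono-≤ (c≥0 k) (d≥0 k)) total
       (coordinate x cx dx) (coordinate y cy dy) (coordinate z cz dz)
  where
  total : Σℚ (λ k → c k ℚ.+ d k) ≡ toℚ (+ (S ℕ.+ T))
  total = begin
    Σℚ (λ k → c k ℚ.+ d k)    ≡⟨ Σℚ-+ c d ⟩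
    Σℚ c ℚ.+ Σℚ d             ≡⟨ cong₂ ℚ._+_ Σc Σd ⟩
    toℚ (+ S) ℚ.+ toℚ (+ T)   ≡⟨ toℚ-+ (+ S) (+ T) ⟨
    toℚ (+ S ℤ.+ + T)         ≡⟨ cong toℚ (ℤP.pos-+ S T) ⟨
    toℚ (+ (S ℕ.+ T))         ∎
    where open ≡-Reasoning
  coordinate : ∀ π → weighted L c π ≡ toℚ (π P) → weighted L d π ≡ toℚ (π Q) →
               weighted L (λ k → c k ℚ.+ d k) π ≡ toℚ (π P ℤ.+ π Q)
  coordinate π hc hd =
    trans (weighted-+ L c d π) (trans (cong₂ ℚ._+_ hc hd) (sym (toℚ-+ (π P) (π Q))))

inCone-rescale : ∀ {L S S′ P P′} r → 0ℚ ℚ.≤ r →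
  toℚ (+ S′) ≡ r ℚ.* toℚ (+ S) →
  toℚ (x P′) ≡ r ℚ.* toℚ (x P) → toℚ (y P′) ≡ r ℚ.* toℚ (y P) → toℚ (z P′) ≡ r ℚ.* toℚ (z P) →
  InCone L S P → InCone L S′ P′
inCone-rescale {L} {P = P} {P′} r r≥0 eS ex ey ez (cone c c≥0 Σc cx cy cz) =
  cone (λ k → r ℚ.* c k) nonneg (trans (Σℚ-*ˡ r c) (trans (cong (r ℚ.*_) Σc) (sym eS)))
       (coordinate x cx ex) (coordinate y cy ey) (coordinate z cz ez)
  where
  nonneg : ∀ k → 0ℚ ℚ.≤ r ℚ.* c k
  nonneg k = ℚP.nonNegative⁻¹ _
    {{ℚP.nonNeg*nonNeg⇒nonNeg r {{ℚ.nonNegative r≥0}} (c k) {{ℚ.nonNegative (c≥0 k)}}}}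
  coordinate : ∀ π → weighted L c π ≡ toℚ (π P) → toℚ (π P′) ≡ r ℚ.* toℚ (π P) →
               weighted L (λ k → r ℚ.* c k) π ≡ toℚ (π P′)
  coordinate π hc e = trans (weighted-*ˡ L r c π) (trans (cong (r ℚ.*_) hc) (sym e))

inCone-• : ∀ {L S P} n → InCone L S P → InCone L (n ℕ.* S) (n • P)
inCone-• {S = S} {P} n =
  inCone-rescale (toℚ (+ n)) (ℚP.nonNegative⁻¹ _ {{ℚP.normalize-nonNeg n 1}})
  (trans (cong toℚ (ℤP.pos-* n S)) (toℚ-* (+ n) (+ S)))
  (toℚ-* (+ n) (x P)) (toℚ-* (+ n) (y P)) (toℚ-* (+ n) (z P))

inCone-divide : ∀ {L S P} n .{{_ : NonZero n}} → InCone L (n ℕ.* S) (n • P) → InCone L S P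
inCone-divide {S = S} {P} n =
  inCone-rescale (+ 1 ℚ./ n) (ℚP.nonNegative⁻¹ _ {{ℚP.normalize-nonNeg 1 n}})
  (cancel (+ S) (ℤP.pos-* n S)) (cancel (x P) refl) (cancel (y P) refl) (cancel (z P) refl)
  where
  cancel : ∀ a {b} → b ≡ + n ℤ.* a → toℚ a ≡ (+ 1 ℚ./ n) ℚ.* toℚ b
  cancel a refl = sym (begin
    (+ 1 ℚ./ n) ℚ.* toℚ (+ n ℤ.* a)          ≡⟨ cong ((+ 1 ℚ./ n) ℚ.*_) (toℚ-* (+ n) a) ⟩
    (+ 1 ℚ./ n) ℚ.* (toℚ (+ n) ℚ.* toℚ a)    ≡⟨ ℚP.*-assoc (+ 1 ℚ./ n) (toℚ (+ n)) (toℚ a) ⟨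
    ((+ 1 ℚ./ n) ℚ.* toℚ (+ n)) ℚ.* toℚ a    ≡⟨ cong (ℚ._* toℚ a) (1/n*n≡1 n) ⟩
    1ℚ ℚ.* toℚ a                             ≡⟨ ℚP.*-identityˡ (toℚ a) ⟩
    toℚ a                                    ∎)
    where open ≡-Reasoning

inCone-mix : ∀ {L S P Q} p q → InCone L S P → InCone L S Q →
  InCone L ((p ℕ.+ q) ℕ.* S) (p • P +³ q • Q)
inCone-mix {L} {S} {P} {Q} p q hP hQ =
  subst (λ T → InCone L T (p • P +³ q • Q)) (sym (ℕP.*-distribʳ-+ S p q))
        (inCone-+ (inCone-• p hP) (inCone-• q hQ))

prism-point : (p q r r′ s s′ : ℕ) (a b c d : ℤ³) → ℤ³
prism-point p q r r′ s s′ a b c d =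
  p • (r′ • (s′ • a +³ s • (a +³ d)) +³ r • (s′ • (a +³ c) +³ s • (a +³ c +³ d))) +³
  q • (r′ • (s′ • b +³ s • (b +³ d)) +³ r • (s′ • (b +³ c) +³ s • (b +³ c +³ d)))

prism-identity : ∀ (p q r r′ s s′ S : ℤ) {Xa Xb Xc Xd X : ℤ} →
  p ℤ.+ q ≡ S → r′ ℤ.+ r ≡ S → s′ ℤ.+ s ≡ S →
  S ℤ.* X ≡ p ℤ.* Xa ℤ.+ (q ℤ.* Xb ℤ.+ (r ℤ.* Xc ℤ.+ s ℤ.* Xd)) →
  p ℤ.* (r′ ℤ.* (s′ ℤ.* Xa ℤ.+ s ℤ.* (Xa ℤ.+ Xd))
         ℤ.+ r ℤ.* (s′ ℤ.* (Xa ℤ.+ Xc) ℤ.+ s ℤ.* (Xa ℤ.+ Xc ℤ.+ Xd)))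
  ℤ.+ q ℤ.* (r′ ℤ.* (s′ ℤ.* Xb ℤ.+ s ℤ.* (Xb ℤ.+ Xd))
             ℤ.+ r ℤ.* (s′ ℤ.* (Xb ℤ.+ Xc) ℤ.+ s ℤ.* (Xb ℤ.+ Xc ℤ.+ Xd)))
  ≡ S ℤ.* (S ℤ.* (S ℤ.* X))
prism-identity p q r r′ s s′ S {Xa} {Xb} {Xc} {Xd} {X} p+q r′+r s′+s SX = begin
  _   ≡⟨ expand p q r r′ s s′ Xa Xb Xc Xd ⟩
  (r′ + r) * ((s′ + s) * (p * Xa + q * Xb)) + (p + q) * ((s′ + s) * (r * Xc))
    + (p + q) * ((r′ + r) * (s * Xd))
      ≡⟨ cong₂ _+_ (cong₂ _+_ (cong₂ _*_ r′+r (cong (_* _) s′+s)) (cong₂ _*_ p+q (cong (_* _) s′+s)))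
                   (cong₂ _*_ p+q (cong (_* _) r′+r)) ⟩
  S * (S * (p * Xa + q * Xb)) + S * (S * (r * Xc)) + S * (S * (s * Xd))
      ≡⟨ collect S (p * Xa) (q * Xb) (r * Xc) (s * Xd) ⟩
  S * (S * (p * Xa + (q * Xb + (r * Xc + s * Xd))))   ≡⟨ cong (λ t → S * (S * t)) SX ⟨
  S * (S * (S * X))                                   ∎
  where
  open ≡-Reasoning
  open import Data.Integer using (_+_; _*_)
  expand : ∀ p q r r′ s s′ Xa Xb Xc Xd →
    p * (r′ * (s′ * Xa + s * (Xa + Xd)) + r * (s′ * (Xa + Xc) + s * (Xa + Xc + Xd)))
    + q * (r′ * (s′ * Xb + s * (Xb + Xd)) + r * (s′ * (Xb + Xc) + s * (Xb + Xc + Xd)))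
    ≡ (r′ + r) * ((s′ + s) * (p * Xa + q * Xb)) + (p + q) * ((s′ + s) * (r * Xc))
      + (p + q) * ((r′ + r) * (s * Xd))
  expand = ℤ-Solver.solve-∀
  collect : ∀ S A B C D → S * (S * (A + B)) + S * (S * C) + S * (S * D) ≡ S * (S * (A + (B + (C + D))))
  collect = ℤ-Solver.solve-∀

-- The weights are products of the three segment weights (p, q), (r′, r) and (s′, s).
inCone-prism : ∀ {L} a b c d {P S} p q r r′ s s′ →
  InCone L 1 a → InCone L 1 (a +³ c) → InCone L 1 (a +³ d) → InCone L 1 (a +³ c +³ d) →
  InCone L 1 b → InCone L 1 (b +³ c) → InCone L 1 (b +³ d) → InCone L 1 (b +³ c +³ d) →
  p ℕ.+ q ≡ S → r′ ℕ.+ r ≡ S → s′ ℕ.+ s ≡ S →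
  S • P ≡ p • a +³ (q • b +³ (r • c +³ s • d)) →
  InCone L (S ℕ.* (S ℕ.* (S ℕ.* 1))) (S • S • S • P)
inCone-prism a b c d {P} {S} p q r r′ s s′ a∈ ac∈ ad∈ acd∈ b∈ bc∈ bd∈ bcd∈ p+q r′+r s′+s SP =
  subst₂ (InCone _) total point
    (inCone-mix p q (inCone-mix r′ r (inCone-mix s′ s a∈ ad∈) (inCone-mix s′ s ac∈ acd∈))
                    (inCone-mix r′ r (inCone-mix s′ s b∈ bd∈) (inCone-mix s′ s bc∈ bcd∈)))
  where
  total : (p ℕ.+ q) ℕ.* ((r′ ℕ.+ r) ℕ.* ((s′ ℕ.+ s) ℕ.* 1)) ≡ S ℕ.* (S ℕ.* (S ℕ.* 1))
  total = cong₂ ℕ._*_ p+q (cong₂ ℕ._*_ r′+r (cong (ℕ._* 1) s′+s))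
  cast : ∀ m n → m ℕ.+ n ≡ S → + m ℤ.+ + n ≡ + S
  cast m n e = trans (sym (ℤP.pos-+ m n)) (cong +_ e)
  e₁ : + p ℤ.+ + q ≡ + S
  e₁ = cast p q p+q
  e₂ : + r′ ℤ.+ + r ≡ + S
  e₂ = cast r′ r r′+r
  e₃ : + s′ ℤ.+ + s ≡ + S
  e₃ = cast s′ s s′+s
  point : prism-point p q r r′ s s′ a b c d ≡ S • S • S • P
  point = ℤ³-ext (prism-identity (+ p) (+ q) (+ r) (+ r′) (+ s) (+ s′) (+ S) e₁ e₂ e₃ (cong x SP))
                 (prism-identity (+ p) (+ q) (+ r) (+ r′) (+ s) (+ s′) (+ S) e₁ e₂ e₃ (cong y SP))
                 (prism-identity (+ p) (+ q) (+ r) (+ r′) (+ s) (+ s′) (+ S) e₁ e₂ e₃ (cong z SP))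

-- Points of D

module _ (w : Fin 4 → ℤ³) where
  open ℤ³-Solver using (solve; _⊕_; _⊜_)

  private
    L : List ℤ³
    L = generatorsD w

    w₀ w₁ w₂ w₃ : ℤ³
    w₀ = w 0F
    w₁ = w 1F
    w₂ = w 2F
    w₃ = w 3F

    vertex : ∀ k {v} → List.lookup L k ≡ v → InCone L 1 v
    vertex k refl = inCone-lookup L k

    comm : ∀ p q → p +³ q ≡ q +³ p
    comm = solve 2 (λ p q → p ⊕ q ⊜ q ⊕ p) refl

    rotate : ∀ p q r → p +³ q +³ r ≡ r +³ p +³ q
    rotate = solve 3 (λ p q r → (p ⊕ q) ⊕ r ⊜ (r ⊕ p) ⊕ q) refl

  inD-rescaled : ∀ {P} S .{{_ : NonZero S}} →
    InCone L (S ℕ.* (S ℕ.* (S ℕ.* 1))) (S • S • S • P) → InD w P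
  inD-rescaled S h = InCone⇒InConvexHull (inCone-divide S (inCone-divide S (inCone-divide S h)))

  -- The numerals are positions in generatorsD; comm and rotate reorder the summands of a vertex.
  inD-pair : ∀ {P} S .{{_ : NonZero S}} (N : Fin 4 → ℕ) → (∀ l → N l ≤ S) → S • P ≡ comb w N →
             ∀ i j → i ≢ j → N i ℕ.+ N j ≡ S → InD w P
  inD-pair {P} S N N≤S SP = pair
    where
    t : Fin 4 → ℤ³
    t l = N l • w l
    t₀ t₁ t₂ t₃ : ℤ³
    t₀ = t 0F
    t₁ = t 1F
    t₂ = t 2F
    t₃ = t 3F
    SP₄ : S • P ≡ t₀ +³ (t₁ +³ (t₂ +³ t₃))
    SP₄ = trans SP (cong (λ q → t₀ +³ (t₁ +³ (t₂ +³ q))) (+³-identityʳ t₃))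
    complement : ∀ l → S ℕ.∸ N l ℕ.+ N l ≡ S
    complement l = ℕP.m∸n+n≡m (N≤S l)
    prism : ∀ i j k l →
      InCone L 1 (w i) → InCone L 1 (w i +³ w k) →
      InCone L 1 (w i +³ w l) → InCone L 1 (w i +³ w k +³ w l) →
      InCone L 1 (w j) → InCone L 1 (w j +³ w k) →
      InCone L 1 (w j +³ w l) → InCone L 1 (w j +³ w k +³ w l) →
      N i ℕ.+ N j ≡ S → S • P ≡ t i +³ (t j +³ (t k +³ t l)) → InD w P
    prism i j k l a ac ad acd b bc bd bcd e SP′ = inD-rescaled S
      (inCone-prism (w i) (w j) (w k) (w l) (N i) (N j) (N k) (S ℕ.∸ N k) (N l) (S ℕ.∸ N l)
                    a ac ad acd b bc bd bcd e (complement k) (complement l) SP′)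
    pair : ∀ i j → i ≢ j → N i ℕ.+ N j ≡ S → InD w P
    pair 0F 1F _ e = prism 0F 1F 2F 3F
      (vertex (# 0) refl) (vertex (# 5) refl) (vertex (# 6) refl) (vertex (# 12) refl)
      (vertex (# 1) refl) (vertex (# 7) refl) (vertex (# 8) refl) (vertex (# 13) refl)
      e SP₄
    pair 0F 2F _ e = prism 0F 2F 1F 3F
      (vertex (# 0) refl) (vertex (# 4) refl) (vertex (# 6) refl) (vertex (# 11) refl)
      (vertex (# 2) refl) (vertex (# 7) (comm w₁ w₂))
      (vertex (# 9) refl) (vertex (# 13) (cong (_+³ w₃) (comm w₁ w₂)))
      e (trans SP₄ (solve 4 (λ a b c d → a ⊕ (b ⊕ (c ⊕ d)) ⊜ a ⊕ (c ⊕ (b ⊕ d))) refl t₀ t₁ t₂ t₃))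
    pair 0F 3F _ e = prism 0F 3F 1F 2F
      (vertex (# 0) refl) (vertex (# 4) refl) (vertex (# 5) refl) (vertex (# 10) refl)
      (vertex (# 3) refl) (vertex (# 8) (comm w₁ w₃))
      (vertex (# 9) (comm w₂ w₃)) (vertex (# 13) (rotate w₁ w₂ w₃))
      e (trans SP₄ (solve 4 (λ a b c d → a ⊕ (b ⊕ (c ⊕ d)) ⊜ a ⊕ (d ⊕ (b ⊕ c))) refl t₀ t₁ t₂ t₃))
    pair 1F 2F _ e = prism 1F 2F 0F 3F
      (vertex (# 1) refl) (vertex (# 4) (comm w₀ w₁))
      (vertex (# 8) refl) (vertex (# 11) (cong (_+³ w₃) (comm w₀ w₁)))
      (vertex (# 2) refl) (vertex (# 5) (comm w₀ w₂))
      (vertex (# 9) refl) (vertex (# 12) (cong (_+³ w₃) (comm w₀ w₂)))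
      e (trans SP₄ (solve 4 (λ a b c d → a ⊕ (b ⊕ (c ⊕ d)) ⊜ b ⊕ (c ⊕ (a ⊕ d))) refl t₀ t₁ t₂ t₃))
    pair 1F 3F _ e = prism 1F 3F 0F 2F
      (vertex (# 1) refl) (vertex (# 4) (comm w₀ w₁))
      (vertex (# 7) refl) (vertex (# 10) (cong (_+³ w₂) (comm w₀ w₁)))
      (vertex (# 3) refl) (vertex (# 6) (comm w₀ w₃))
      (vertex (# 9) (comm w₂ w₃)) (vertex (# 12) (rotate w₀ w₂ w₃))
      e (trans SP₄ (solve 4 (λ a b c d → a ⊕ (b ⊕ (c ⊕ d)) ⊜ b ⊕ (d ⊕ (a ⊕ c))) refl t₀ t₁ t₂ t₃))
    pair 2F 3F _ e = prism 2F 3F 0F 1F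
      (vertex (# 2) refl) (vertex (# 5) (comm w₀ w₂))
      (vertex (# 7) (comm w₁ w₂)) (vertex (# 10) (rotate w₀ w₁ w₂))
      (vertex (# 3) refl) (vertex (# 6) (comm w₀ w₃))
      (vertex (# 8) (comm w₁ w₃)) (vertex (# 11) (rotate w₀ w₁ w₃))
      e (trans SP₄ (solve 4 (λ a b c d → a ⊕ (b ⊕ (c ⊕ d)) ⊜ c ⊕ (d ⊕ (a ⊕ b))) refl t₀ t₁ t₂ t₃))
    pair 1F 0F i≢j e = pair 0F 1F (i≢j ∘ sym) (trans (ℕP.+-comm (N 0F) (N 1F)) e)
    pair 2F 0F i≢j e = pair 0F 2F (i≢j ∘ sym) (trans (ℕP.+-comm (N 0F) (N 2F)) e)
    pair 3F 0F i≢j e = pair 0F 3F (i≢j ∘ sym) (trans (ℕP.+-comm (N 0F) (N 3F)) e)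
    pair 2F 1F i≢j e = pair 1F 2F (i≢j ∘ sym) (trans (ℕP.+-comm (N 1F) (N 2F)) e)
    pair 3F 1F i≢j e = pair 1F 3F (i≢j ∘ sym) (trans (ℕP.+-comm (N 1F) (N 3F)) e)
    pair 3F 2F i≢j e = pair 2F 3F (i≢j ∘ sym) (trans (ℕP.+-comm (N 2F) (N 3F)) e)
    pair 0F 0F i≢i _ = ⊥-elim (i≢i refl)
    pair 1F 1F i≢i _ = ⊥-elim (i≢i refl)
    pair 2F 2F i≢i _ = ⊥-elim (i≢i refl)
    pair 3F 3F i≢i _ = ⊥-elim (i≢i refl)

-- Balanced vectors and the greedy chain

infix 4 _÷_≼_÷_
record _÷_≼_÷_ (m n m′ n′ : ℕ) : Set where
  constructor cross-≤
  field cross : m ℕ.* n′ ≤ m′ ℕ.* n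
open _÷_≼_÷_

≼-total : ∀ {m n m′ n′} → ¬ m ÷ n ≼ m′ ÷ n′ → m′ ÷ n′ ≼ m ÷ n
≼-total m÷n⋠m′÷n′ = cross-≤ (ℕP.<⇒≤ (ℕP.≰⇒> (m÷n⋠m′÷n′ ∘ cross-≤)))

≼-trans : ∀ {m n m′ n′ m″ n″} → 0 < n′ → m ÷ n ≼ m′ ÷ n′ → m′ ÷ n′ ≼ m″ ÷ n″ → m ÷ n ≼ m″ ÷ n″
≼-trans {m} {n} {m′} {n′} {m″} {n″} n′>0 (cross-≤ h₁) (cross-≤ h₂) =
  cross-≤ (ℕP.*-cancelʳ-≤ (m ℕ.* n″) (m″ ℕ.* n) n′ {{ℕ.>-nonZero n′>0}} (begin
    m ℕ.* n″ ℕ.* n′    ≡⟨ swap m n″ n′ ⟩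
    m ℕ.* n′ ℕ.* n″    ≤⟨ ℕP.*-monoˡ-≤ n″ h₁ ⟩
    m′ ℕ.* n ℕ.* n″    ≡⟨ swap m′ n n″ ⟩
    m′ ℕ.* n″ ℕ.* n    ≤⟨ ℕP.*-monoˡ-≤ n h₂ ⟩
    m″ ℕ.* n′ ℕ.* n    ≡⟨ swap m″ n′ n ⟩
    m″ ℕ.* n ℕ.* n′    ∎))
  where
  open ℕP.≤-Reasoning
  swap : ∀ a b c → a ℕ.* b ℕ.* c ≡ a ℕ.* c ℕ.* b
  swap = ℕ-Solver.solve-∀

≼-mediantʳ : ∀ {u v p q p′ q′} → u ÷ v ≼ p ÷ q → u ÷ v ≼ p′ ÷ q′ → u ÷ v ≼ (p ℕ.+ p′) ÷ (q ℕ.+ q′)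
≼-mediantʳ {u} {v} {p} {q} {p′} {q′} (cross-≤ h) (cross-≤ h′) = cross-≤ (begin
  u ℕ.* (q ℕ.+ q′)        ≡⟨ ℕP.*-distribˡ-+ u q q′ ⟩
  u ℕ.* q ℕ.+ u ℕ.* q′    ≤⟨ ℕP.+-mono-≤ h h′ ⟩
  p ℕ.* v ℕ.+ p′ ℕ.* v    ≡⟨ ℕP.*-distribʳ-+ v p p′ ⟨
  (p ℕ.+ p′) ℕ.* v        ∎)
  where open ℕP.≤-Reasoning

≼-mediantˡ : ∀ {u v p q p′ q′} → p ÷ q ≼ u ÷ v → p′ ÷ q′ ≼ u ÷ v → (p ℕ.+ p′) ÷ (q ℕ.+ q′) ≼ u ÷ v
≼-mediantˡ {u} {v} {p} {q} {p′} {q′} (cross-≤ h) (cross-≤ h′) = cross-≤ (begin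
  (p ℕ.+ p′) ℕ.* v        ≡⟨ ℕP.*-distribʳ-+ v p p′ ⟩
  p ℕ.* v ℕ.+ p′ ℕ.* v    ≤⟨ ℕP.+-mono-≤ h h′ ⟩
  u ℕ.* q ℕ.+ u ℕ.* q′    ≡⟨ ℕP.*-distribˡ-+ u q q′ ⟨
  u ℕ.* (q ℕ.+ q′)        ∎)
  where open ℕP.≤-Reasoning

module _ {A : Set} (_≤_ : A → A → Set) (_≤?_ : ∀ a b → Dec (a ≤ b)) where

  argmin : ∀ {m} → (Fin (suc m) → A) → Fin (suc m)
  argmin {zero}  f = zero
  argmin {suc m} f with f zero ≤? f (suc (argmin (f ∘ suc)))
  ... | yes _ = zero
  ... | no  _ = suc (argmin (f ∘ suc))

  private
    reflexive : ∀ {m} (f : Fin m → A) → (∀ i j → ¬ f i ≤ f j → f j ≤ f i) → ∀ i → f i ≤ f i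
    reflexive f total i with f i ≤? f i
    ... | yes fi≤fi = fi≤fi
    ... | no  fi≰fi = total i i fi≰fi

  argmin-≤ : ∀ {m} (f : Fin (suc m) → A) →
    (∀ i j → ¬ f i ≤ f j → f j ≤ f i) → (∀ {i j k} → f i ≤ f j → f j ≤ f k → f i ≤ f k) →
    ∀ l → f (argmin f) ≤ f l
  argmin-≤ {zero}  f total trans zero = reflexive f total zero
  argmin-≤ {suc m} f total trans l with f zero ≤? f (suc (argmin (f ∘ suc))) | l
  ... | yes _   | zero   = reflexive f total zero
  ... | yes f₀≤ | suc l′ = trans f₀≤ (argmin-≤ (f ∘ suc) (λ i j → total (suc i) (suc j)) trans l′)
  ... | no  f₀≰ | zero   = total zero _ f₀≰
  ... | no  _   | suc l′ = argmin-≤ (f ∘ suc) (λ i j → total (suc i) (suc j)) trans l′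

Balanced : ∀ {m} → (a b : Fin m → ℕ) → Set
Balanced a b = ∀ l l′ → b l ÷ a l ≼ suc (b l′) ÷ a l′

Straddles : ∀ {m} → (a b : Fin m → ℕ) → ℕ → ℕ → Set
Straddles a b T S = ∀ l → b l ÷ a l ≼ T ÷ S × T ÷ S ≼ suc (b l) ÷ a l

mediant-straddles : ∀ {m} (a b : Fin m → ℕ) → Balanced a b → ∀ i j → (∀ l → b l ÷ a l ≼ b i ÷ a i) →
  (∀ l → suc (b i) ÷ a i ≼ suc (b l) ÷ a l) ⊎ (∀ l → suc (b j) ÷ a j ≼ suc (b l) ÷ a l) →
  Straddles a b (suc (b i ℕ.+ b j)) (a i ℕ.+ a j)
mediant-straddles a b balanced i j i-top least l = lower , upper least
  where
  S : ℕ
  S = a i ℕ.+ a j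
  lower : b l ÷ a l ≼ suc (b i ℕ.+ b j) ÷ S
  lower = subst (λ T → b l ÷ a l ≼ T ÷ S) (ℕP.+-suc (b i) (b j)) (≼-mediantʳ (i-top l) (balanced l j))
  upper : (∀ l → suc (b i) ÷ a i ≼ suc (b l) ÷ a l) ⊎ (∀ l → suc (b j) ÷ a j ≼ suc (b l) ÷ a l) →
          suc (b i ℕ.+ b j) ÷ S ≼ suc (b l) ÷ a l
  upper (inj₁ i-least) = ≼-mediantˡ (i-least l) (balanced j l)
  upper (inj₂ j-least) = subst (λ T → T ÷ S ≼ suc (b l) ÷ a l) (ℕP.+-suc (b i) (b j))
                               (≼-mediantˡ (balanced i l) (j-least l))

module Greedy {m} (a : Fin (suc m) → ℕ) (a>0 : ∀ l → 0 < a l) where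

  private
    _≼_ : ℕ × ℕ → ℕ × ℕ → Set
    (p , q) ≼ (p′ , q′) = p ÷ q ≼ p′ ÷ q′

    _≼?_ : ∀ f g → Dec (f ≼ g)
    (p , q) ≼? (p′ , q′) = Dec.map′ cross-≤ cross (p ℕ.* q′ ℕ.≤? p′ ℕ.* q)

  next : (Fin (suc m) → ℕ) → Fin (suc m)
  next b = argmin _≼_ _≼?_ (λ l → suc (b l) , a l)

  next-least : ∀ b l → suc (b (next b)) ÷ a (next b) ≼ suc (b l) ÷ a l
  next-least b = argmin-≤ _≼_ _≼?_ (λ l → suc (b l) , a l) (λ _ _ → ≼-total)
                          (λ {_} {j} → ≼-trans (a>0 j))

  top : (Fin (suc m) → ℕ) → Fin (suc m)
  top b = argmin (flip _≼_) (flip _≼?_) (λ l → b l , a l)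

  top-greatest : ∀ b l → b l ÷ a l ≼ b (top b) ÷ a (top b)
  top-greatest b = argmin-≤ (flip _≼_) (flip _≼?_) (λ l → b l , a l) (λ _ _ → ≼-total)
                            (λ {_} {j} h₁ h₂ → ≼-trans (a>0 j) h₂ h₁)

  chain : ℕ → Fin (suc m) → ℕ
  chain zero    l = 0
  chain (suc k) l = δ (next (chain k)) l ℕ.+ chain k l

  chain-sum : ∀ k → ℕΣ.sum (chain k) ≡ k
  chain-sum zero    = ℕΣ.sum-replicate-zero (suc m)
  chain-sum (suc k) = trans (ℕΣ.∑-distrib-+ (δ (next (chain k))) (chain k))
                            (cong₂ ℕ._+_ (sum-δ (next (chain k))) (chain-sum k))

  chain-mono : ∀ {k k′} → k ≤ k′ → ∀ l → chain k l ≤ chain k′ l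
  chain-mono {k′ = zero}   z≤n  l = ℕP.≤-refl
  chain-mono {k′ = suc k′} k≤k′ l with ℕP.m≤n⇒m<n∨m≡n k≤k′
  ... | inj₁ k<k′ = ℕP.≤-trans (chain-mono (ℕP.≤-pred k<k′) l)
                               (ℕP.m≤n+m (chain k′ l) (δ (next (chain k′)) l))
  ... | inj₂ refl = ℕP.≤-refl

  chain-balanced : ∀ k → Balanced a (chain k)
  chain-balanced zero    l l′ = cross-≤ z≤n
  chain-balanced (suc k) l l′ with next (chain k) F.≟ l | next (chain k) F.≟ l′
  ... | yes refl | yes refl rewrite δ-diag l =
        cross-≤ (ℕP.*-monoˡ-≤ (a l) (ℕP.n≤1+n (suc (chain k l))))
  ... | yes refl | no n≢l′ rewrite δ-diag l | δ-off n≢l′ =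
        next-least (chain k) l′
  ... | no n≢l   | yes refl rewrite δ-off n≢l | δ-diag l′ =
        cross-≤ (ℕP.≤-trans (cross (chain-balanced k l l′))
                            (ℕP.*-monoˡ-≤ (a l) (ℕP.n≤1+n (suc (chain k l′)))))
  ... | no n≢l   | no n≢l′ rewrite δ-off n≢l | δ-off n≢l′ =
        chain-balanced k l l′

  saturated : ∀ b → a (next b) ≤ b (next b) → ∀ l → a l ≤ b l
  saturated b a≤b l with a l ℕ.≤? b l
  ... | yes a≤bl = a≤bl
  ... | no  a≰bl = ⊥-elim (ℕP.<⇒≱ too-small (cross (next-least b l)))
    where
    n : Fin (suc m)
    n = next b
    too-small : suc (b l) ℕ.* a n < suc (b n) ℕ.* a l
    too-small = begin-strict
      suc (b l) ℕ.* a n     ≤⟨ ℕP.*-monoˡ-≤ (a n) (ℕP.≰⇒> a≰bl) ⟩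
      a l ℕ.* a n           ≤⟨ ℕP.*-monoʳ-≤ (a l) a≤b ⟩
      a l ℕ.* b n           <⟨ ℕP.m<n+m (a l ℕ.* b n) (a>0 l) ⟩
      a l ℕ.+ a l ℕ.* b n   ≡⟨ cong (a l ℕ.+_) (ℕP.*-comm (a l) (b n)) ⟩
      suc (b n) ℕ.* a l     ∎
      where open ℕP.≤-Reasoning

  chain-bounded : ∀ {k} → k ≤ ℕΣ.sum a → ∀ l → chain k l ≤ a l
  chain-bounded {zero}  _    l = z≤n
  chain-bounded {suc k} k<Σa l with next (chain k) F.≟ l
  ... | yes refl rewrite δ-diag l = room
    where
    room : chain k l < a l
    room with chain k l ℕ.<? a l
    ... | yes room = room
    ... | no  full = ⊥-elim (ℕP.<⇒≱ k<Σa (subst (ℕΣ.sum a ≤_) (chain-sum k)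
                                               (sum-mono (saturated (chain k) (ℕP.≮⇒≥ full)))))
  ... | no n≢l rewrite δ-off n≢l = chain-bounded (ℕP.<⇒≤ k<Σa) l

  straddling-pair : (∀ (i : Fin (suc m)) → ∃ (i ≢_)) → ∀ b → Balanced a b →
    ∃₂ λ i j → i ≢ j × Straddles a b (suc (b i ℕ.+ b j)) (a i ℕ.+ a j)
  straddling-pair another b balanced with next b F.≟ top b
  ... | yes n≡t = top b , proj₁ (another (top b)) , proj₂ (another (top b)) ,
        mediant-straddles a b balanced (top b) _ (top-greatest b)
          (inj₁ (subst (λ i → ∀ l → suc (b i) ÷ a i ≼ suc (b l) ÷ a l) n≡t (next-least b)))
  ... | no  n≢t = top b , next b , n≢t ∘ sym ,
        mediant-straddles a b balanced (top b) (next b) (top-greatest b) (inj₂ (next-least b))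

-- With S = aᵢ + aⱼ and T = bᵢ + bⱼ + 1, Σ aₗ wₗ = 0 gives S • P = Σ Nₗ wₗ where Nₗ = S (bₗ + 1) − T aₗ,
-- and straddling is exactly 0 ≤ Nₗ ≤ S.
inD-straddling : ∀ (w : Fin 4 → ℤ³) (a b : Fin 4 → ℕ) → (∀ l → 0 < a l) → comb w a ≡ 0³ →
  ∀ i j → i ≢ j → Straddles a b (suc (b i ℕ.+ b j)) (a i ℕ.+ a j) → InD w (comb w (λ l → suc (b l)))
inD-straddling w a b a>0 relation i j i≢j straddle = inD-pair w S N N≤S SP i j i≢j Nᵢ+Nⱼ
  where
  S T : ℕ
  S = a i ℕ.+ a j
  T = suc (b i ℕ.+ b j)
  instance
    S≢0 : NonZero S
    S≢0 = ℕ.>-nonZero (ℕP.<-≤-trans (a>0 i) (ℕP.m≤m+n (a i) (a j)))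
  N : Fin 4 → ℕ
  N l = S ℕ.* suc (b l) ℕ.∸ T ℕ.* a l
  N-split : ∀ l → T ℕ.* a l ℕ.+ N l ≡ S ℕ.* suc (b l)
  N-split l = ℕP.m+[n∸m]≡n (subst (T ℕ.* a l ≤_) (ℕP.*-comm (suc (b l)) S) (cross (proj₂ (straddle l))))
  N≤S : ∀ l → N l ≤ S
  N≤S l = begin
    S ℕ.* suc (b l) ℕ.∸ T ℕ.* a l    ≤⟨ ℕP.∸-monoʳ-≤ (S ℕ.* suc (b l)) (cross (proj₁ (straddle l))) ⟩
    S ℕ.* suc (b l) ℕ.∸ b l ℕ.* S    ≡⟨ cong (ℕ._∸ b l ℕ.* S) (trans (ℕP.*-suc S (b l))
                                                                   (cong (S ℕ.+_) (ℕP.*-comm S (b l)))) ⟩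
    S ℕ.+ b l ℕ.* S ℕ.∸ b l ℕ.* S    ≡⟨ ℕP.m+n∸n≡m S (b l ℕ.* S) ⟩
    S                                ∎
    where open ℕP.≤-Reasoning
  Nᵢ+Nⱼ : N i ℕ.+ N j ≡ S
  Nᵢ+Nⱼ = ℕP.+-cancelˡ-≡ (T ℕ.* S) (N i ℕ.+ N j) S (begin
    T ℕ.* S ℕ.+ (N i ℕ.+ N j)                      ≡⟨ regroup T (a i) (a j) (N i) (N j) ⟩
    (T ℕ.* a i ℕ.+ N i) ℕ.+ (T ℕ.* a j ℕ.+ N j)   ≡⟨ cong₂ ℕ._+_ (N-split i) (N-split j) ⟩
    S ℕ.* suc (b i) ℕ.+ S ℕ.* suc (b j)            ≡⟨ collect S (b i) (b j) ⟩
    T ℕ.* S ℕ.+ S                                  ∎)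
    where
    open ≡-Reasoning
    open import Data.Nat using (_+_; _*_)
    regroup : ∀ t aᵢ aⱼ nᵢ nⱼ → t * (aᵢ + aⱼ) + (nᵢ + nⱼ) ≡ (t * aᵢ + nᵢ) + (t * aⱼ + nⱼ)
    regroup = ℕ-Solver.solve-∀
    collect : ∀ s bᵢ bⱼ → s * (1 + bᵢ) + s * (1 + bⱼ) ≡ (1 + (bᵢ + bⱼ)) * s + s
    collect = ℕ-Solver.solve-∀
  SP : S • comb w (λ l → suc (b l)) ≡ comb w N
  SP = begin
    S • comb w (λ l → suc (b l))              ≡⟨ comb-* w S (λ l → suc (b l)) ⟨
    comb w (λ l → S ℕ.* suc (b l))            ≡⟨ comb-cong w (λ l → sym (N-split l)) ⟩
    comb w (λ l → T ℕ.* a l ℕ.+ N l)          ≡⟨ comb-+ w (λ l → T ℕ.* a l) N ⟩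
    comb w (λ l → T ℕ.* a l) +³ comb w N      ≡⟨ cong (_+³ comb w N) (comb-* w T a) ⟩
    T • comb w a +³ comb w N                  ≡⟨ cong (λ q → T • q +³ comb w N) relation ⟩
    T • 0³ +³ comb w N                        ≡⟨ cong (_+³ comb w N) (•-zeroʳ T) ⟩
    0³ +³ comb w N                            ≡⟨ +³-identityˡ (comb w N) ⟩
    comb w N                                  ∎
    where open ≡-Reasoning

-- Multiplicities and sub-multisets

count : ∀ {n m} → (Fin n → Fin m) → Fin m → ℕ
count {zero}  g j = 0
count {suc n} g j = δ (g zero) j ℕ.+ count (g ∘ suc) j

sum-count : ∀ {n m} (g : Fin n → Fin m) → ℕΣ.sum (count g) ≡ n
sum-count {zero}  {m} g = ℕΣ.sum-replicate-zero m
sum-count {suc n}     g = trans (ℕΣ.∑-distrib-+ (δ (g zero)) (count (g ∘ suc)))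
                                (cong₂ ℕ._+_ (sum-δ (g zero)) (sum-count (g ∘ suc)))

count-pos : ∀ {n m} (g : Fin n → Fin m) p → 0 < count g (g p)
count-pos g zero    rewrite δ-diag (g zero) = s≤s z≤n
count-pos g (suc p) = ℕP.<-≤-trans (count-pos (g ∘ suc) p) (ℕP.m≤n+m _ (δ (g zero) (g (suc p))))

0<∣p∣⇒nonempty : ∀ {n} (p : Subset n) → 0 < ∣ p ∣ → Nonempty p
0<∣p∣⇒nonempty {n} p ∣p∣>0 with SP.nonempty? p
... | yes nonempty = nonempty
... | no  empty    = ⊥-elim (ℕP.<⇒≢ ∣p∣>0 (sym (trans (cong ∣_∣ (SP.Empty-unique empty)) (SP.∣⊥∣≡0 n))))

∣p∣<n⇒∃∉p : ∀ {n} (p : Subset n) → ∣ p ∣ < n → ∃ λ i → i ∉ p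
∣p∣<n⇒∃∉p {n} p ∣p∣<n = FP.¬∀⟶∃¬ n (_∈ p) (SP._∈? p) not-all
  where
  not-all : ¬ (∀ i → i ∈ p)
  not-all ∈p = ℕP.<⇒≱ ∣p∣<n (subst (_≤ ∣ p ∣) (SP.∣⊤∣≡n n) (SP.p⊆q⇒∣p∣≤∣q∣ {p = ⊤} (λ {i} _ → ∈p i)))

ProperSubsumsNonzero : ∀ {m} → (Fin m → ℤ³) → (Fin m → ℕ) → Set
ProperSubsumsNonzero w a = ∀ d → (∀ l → d l ≤ a l) → 0 < ℕΣ.sum d → ℕΣ.sum d < ℕΣ.sum a → comb w d ≢ 0³

module _ {m} (w : Fin m → ℤ³) where

  Σ³≡comb-count : ∀ {n} (u : Fin n → ℤ³) (g : Fin n → Fin m) → (∀ p → u p ≡ w (g p)) →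
    Σ³ u ≡ comb w (count g)
  Σ³≡comb-count {zero}  u g u≡wg = sym (comb-zero w (λ _ → refl))
  Σ³≡comb-count {suc n} u g u≡wg =
    trans (cong₂ _+³_ (u≡wg zero) (Σ³≡comb-count (u ∘ suc) (g ∘ suc) (u≡wg ∘ suc)))
          (sym (comb-δ+ w (g zero) (count (g ∘ suc))))

  submultiset : ∀ {n} (u : Fin n → ℤ³) (g : Fin n → Fin m) → (∀ p → u p ≡ w (g p)) →
    ∀ d → (∀ l → d l ≤ count g l) → Σ (Subset n) λ I → Σ³[ I ] u ≡ comb w d × ∣ I ∣ ≡ ℕΣ.sum d
  submultiset {zero} u g _ d d≤0 =
    [] , sym (comb-zero w d≡0) , sym (trans (ℕΣ.sum-cong-≗ d≡0) (ℕΣ.sum-replicate-zero m))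
    where
    d≡0 : ∀ l → d l ≡ 0
    d≡0 l = ℕP.n≤0⇒n≡0 (d≤0 l)
  submultiset {suc n} u g u≡wg d d≤ with d (g zero) in d₀
  ... | zero  = outside ∷ I , trans (+³-identityˡ (Σ³[ I ] (u ∘ suc))) ΣI , ∣I∣
    where
    d≤′ : ∀ l → d l ≤ count (g ∘ suc) l
    d≤′ l with g zero F.≟ l
    ... | yes refl = subst (_≤ count (g ∘ suc) l) (sym d₀) z≤n
    ... | no  g₀≢l = subst (λ k → d l ≤ k ℕ.+ count (g ∘ suc) l) (δ-off g₀≢l) (d≤ l)
    rest : Σ (Subset n) λ I → Σ³[ I ] (u ∘ suc) ≡ comb w d × ∣ I ∣ ≡ ℕΣ.sum d
    rest = submultiset (u ∘ suc) (g ∘ suc) (u≡wg ∘ suc) d d≤′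
    I : Subset n
    I = proj₁ rest
    ΣI : Σ³[ I ] (u ∘ suc) ≡ comb w d
    ΣI = proj₁ (proj₂ rest)
    ∣I∣ : ∣ I ∣ ≡ ℕΣ.sum d
    ∣I∣ = proj₂ (proj₂ rest)
  ... | suc _ = inside ∷ I , ΣI , ∣I∣
    where
    j : Fin m
    j = g zero
    d′ : Fin m → ℕ
    d′ l = d l ℕ.∸ δ j l
    δ≤d : ∀ l → δ j l ≤ d l
    δ≤d l with j F.≟ l
    ... | yes refl = subst (_≤ d j) (sym (δ-diag j)) (subst (1 ≤_) (sym d₀) (s≤s z≤n))
    ... | no  j≢l  = subst (_≤ d l) (sym (δ-off j≢l)) z≤n
    d-split : ∀ l → δ j l ℕ.+ d′ l ≡ d l
    d-split l = ℕP.m+[n∸m]≡n (δ≤d l)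
    rest : Σ (Subset n) λ I → Σ³[ I ] (u ∘ suc) ≡ comb w d′ × ∣ I ∣ ≡ ℕΣ.sum d′
    rest = submultiset (u ∘ suc) (g ∘ suc) (u≡wg ∘ suc) d′ (λ l → ℕP.m≤n+o⇒m∸n≤o (d l) (δ j l) (d≤ l))
    I : Subset n
    I = proj₁ rest
    ΣI : u zero +³ Σ³[ I ] (u ∘ suc) ≡ comb w d
    ΣI = begin
      u zero +³ Σ³[ I ] (u ∘ suc)    ≡⟨ cong₂ _+³_ (u≡wg zero) (proj₁ (proj₂ rest)) ⟩
      w j +³ comb w d′               ≡⟨ comb-δ+ w j d′ ⟨
      comb w (λ l → δ j l ℕ.+ d′ l)  ≡⟨ comb-cong w d-split ⟩
      comb w d                       ∎
      where open ≡-Reasoning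
    ∣I∣ : suc ∣ I ∣ ≡ ℕΣ.sum d
    ∣I∣ = begin
      suc ∣ I ∣                        ≡⟨ cong suc (proj₂ (proj₂ rest)) ⟩
      1 ℕ.+ ℕΣ.sum d′                  ≡⟨ cong (ℕ._+ ℕΣ.sum d′) (sum-δ j) ⟨
      ℕΣ.sum (δ j) ℕ.+ ℕΣ.sum d′       ≡⟨ ℕΣ.∑-distrib-+ (δ j) d′ ⟨
      ℕΣ.sum (λ l → δ j l ℕ.+ d′ l)   ≡⟨ ℕΣ.sum-cong-≗ d-split ⟩
      ℕΣ.sum d                         ∎
      where open ≡-Reasoning

  minimal⇒proper-subsums-nonzero : ∀ {n} (u : Fin n → ℤ³) (g : Fin n → Fin m) → (∀ p → u p ≡ w (g p)) →
    IsMinimalZeroSum u → ProperSubsumsNonzero w (count g)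
  minimal⇒proper-subsums-nonzero {n} u g u≡wg (_ , minimal) d d≤ Σd>0 Σd<Σcount combd≡0 =
    minimal I (0<∣p∣⇒nonempty I (subst (0 <_) (sym ∣I∣) Σd>0))
              (∣p∣<n⇒∃∉p I (subst₂ _<_ (sym ∣I∣) (sum-count g) Σd<Σcount))
              (trans ΣI combd≡0)
    where
    I : Subset n
    I = proj₁ (submultiset u g u≡wg d d≤)
    ΣI : Σ³[ I ] u ≡ comb w d
    ΣI = proj₁ (proj₂ (submultiset u g u≡wg d d≤))
    ∣I∣ : ∣ I ∣ ≡ ℕΣ.sum d
    ∣I∣ = proj₂ (proj₂ (submultiset u g u≡wg d d≤))

-- Distinct points of D

module _ {m} (w : Fin (suc m) → ℤ³) (a : Fin (suc m) → ℕ) (a>0 : ∀ l → 0 < a l) where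
  open Greedy a a>0

  chain-point : ℕ → ℤ³
  chain-point k = comb w (λ l → suc (chain k l))

  chain-point-distinct : ProperSubsumsNonzero w a →
    ∀ {k k′} → k < k′ → k′ < ℕΣ.sum a → chain-point k ≢ chain-point k′
  chain-point-distinct nonzero {k} {k′} k<k′ k′<Σa same = nonzero d d≤a Σd>0 Σd<Σa combd≡0
    where
    d : Fin (suc m) → ℕ
    d l = chain k′ l ℕ.∸ chain k l
    chain-split : ∀ l → chain k l ℕ.+ d l ≡ chain k′ l
    chain-split l = ℕP.m+[n∸m]≡n (chain-mono (ℕP.<⇒≤ k<k′) l)
    d≤a : ∀ l → d l ≤ a l
    d≤a l = ℕP.≤-trans (ℕP.m∸n≤m (chain k′ l) (chain k l)) (chain-bounded (ℕP.<⇒≤ k′<Σa) l)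
    k+Σd : k ℕ.+ ℕΣ.sum d ≡ k′
    k+Σd = begin
      k ℕ.+ ℕΣ.sum d                      ≡⟨ cong (ℕ._+ ℕΣ.sum d) (chain-sum k) ⟨
      ℕΣ.sum (chain k) ℕ.+ ℕΣ.sum d       ≡⟨ ℕΣ.∑-distrib-+ (chain k) d ⟨
      ℕΣ.sum (λ l → chain k l ℕ.+ d l)   ≡⟨ ℕΣ.sum-cong-≗ chain-split ⟩
      ℕΣ.sum (chain k′)                   ≡⟨ chain-sum k′ ⟩
      k′                                  ∎
      where open ≡-Reasoning
    Σd>0 : 0 < ℕΣ.sum d
    Σd>0 = ℕP.+-cancelˡ-< k 0 (ℕΣ.sum d) (subst₂ _<_ (sym (ℕP.+-identityʳ k)) (sym k+Σd) k<k′)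
    Σd<Σa : ℕΣ.sum d < ℕΣ.sum a
    Σd<Σa = ℕP.≤-<-trans (subst (ℕΣ.sum d ≤_) k+Σd (ℕP.m≤n+m (ℕΣ.sum d) k)) k′<Σa
    combd≡0 : comb w d ≡ 0³
    combd≡0 = +³-identityʳ-unique (chain-point k) (comb w d) (begin
      chain-point k +³ comb w d                ≡⟨ comb-+ w (λ l → suc (chain k l)) d ⟨
      comb w (λ l → suc (chain k l ℕ.+ d l))   ≡⟨ comb-cong w (λ l → cong suc (chain-split l)) ⟩
      chain-point k′                           ≡⟨ same ⟨
      chain-point k                            ∎)
      where open ≡-Reasoning

  chain-point-injective : ProperSubsumsNonzero w a →
    ∀ {k k′} → k < ℕΣ.sum a → k′ < ℕΣ.sum a → chain-point k ≡ chain-point k′ → k ≡ k′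
  chain-point-injective nonzero {k} {k′} k<Σa k′<Σa same with ℕP.<-cmp k k′
  ... | tri< k<k′ _ _ = ⊥-elim (chain-point-distinct nonzero k<k′ k′<Σa same)
  ... | tri≈ _ k≡k′ _ = k≡k′
  ... | tri> _ _ k′<k = ⊥-elim (chain-point-distinct nonzero k′<k k<Σa (sym same))

other : ∀ {m} (i : Fin (suc (suc m))) → ∃ (i ≢_)
other zero    = suc zero , λ ()
other (suc _) = zero , λ ()

chain-point∈D : ∀ (w : Fin 4 → ℤ³) a (a>0 : ∀ l → 0 < a l) → comb w a ≡ 0³ →
  ∀ k → InD w (chain-point w a a>0 k)
chain-point∈D w a a>0 relation k =
  let (i , j , i≢j , straddle) = straddling-pair other (chain k) (chain-balanced k)
  in  inD-straddling w a (chain k) a>0 relation i j i≢j straddle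
  where open Greedy a a>0

corollary15 : (n : ℕ) → 4 ≤ n → (u : Fin n → ℤ³) → IsMinimalZeroSum u →
    (w : Fin 4 → ℤ³) → SupportIs u w →
    Σ (Fin n → ℤ³) (λ f → Injective _≡_ _≡_ f × ((i : Fin n) → InD w (f i)))
corollary15 n _ u minimal@(zero-sum , _) w (w-injective , u∈w , w∈u) =
  point , point-injective , λ k → chain-point∈D w a a>0 relation (F.toℕ k)
  where
  g : Fin n → Fin 4
  g p = proj₁ (u∈w p)
  u≡wg : ∀ p → u p ≡ w (g p)
  u≡wg p = proj₂ (u∈w p)
  a : Fin 4 → ℕ
  a = count g
  a>0 : ∀ j → 0 < a j
  a>0 j with w∈u j
  ... | p , up≡wj = subst (λ i → 0 < a i) (w-injective (trans (sym (u≡wg p)) up≡wj)) (count-pos g p)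
  relation : comb w a ≡ 0³
  relation = trans (sym (Σ³≡comb-count w u g u≡wg)) zero-sum
  point : Fin n → ℤ³
  point k = chain-point w a a>0 (F.toℕ k)
  below : ∀ k → F.toℕ k < ℕΣ.sum a
  below k = subst (F.toℕ k <_) (sym (sum-count g)) (FP.toℕ<n k)
  point-injective : Injective _≡_ _≡_ point
  point-injective {k} {k′} = FP.toℕ-injective ∘ chain-point-injective w a a>0
    (minimal⇒proper-subsums-nonzero w u g u≡wg minimal) (below k) (below k′)
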